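{- Let $n \ge 2$ be an integer. Start at the permutation $n\,(n{ - }1)\,\cdots\,2\,1$ (one-line notation) and, reading the bits of $S_n = x_1 x_2 \cdots x_{n!}$ from left to right, apply $\phi(x_1), \phi(x_2), \ldots, \phi(x_{n!})$ in succession. Then the resulting sequence of permutations $\phi(S_n)$ is a Hamilton cycle in the directed Cayley graph $\Xi_n$: the $n!$ permutations visited (the starting one and the results of the first $n!-1$ applications) are exactly all the permutations of $\{1,\ldots,n\}$, each visited once, and the last application returns to the starting permutation.
   Context: For $1\le k \le n$, let $\sigma_k = (1\ 2\ \cdots\ k)$, acting on positions of a permutation written in one-line notation: $\sigma_k(x_1 x_2 \cdots x_n) = x_2 x_3 \cdots x_k\, x_1\, x_{k+1} \cdots x_n$. The directed Cayley graph $\Xi_n = \overrightarrow{\mathrm{Cay}}(\{\sigma_n,\sigma_{n-1}\} : \mathbb{S}_n)$ has as vertices all permutations of $\{1,\ldots,n\}$ and directed edges $g \to \sigma_n g$ and $g \to \sigma_{n-1} g$. Binary strings $S_n$ of length $n!$ are defined recursively: $S_2 = 00$, and for $n \ge 2$, if $S_n = x_1 x_2 \cdots x_{n!}$ then $S_{n+1} = 0\,0\,1^{n-2}\,\overline{x}_1\; 0\,0\,1^{n-2}\,\overline{x}_2 \cdots 0\,0\,1^{n-2}\,\overline{x}_{n!}$, where $\overline{x}$ is the complement of the bit $x$, $1^{m}$ denotes $m$ copies of $1$ and $1^0$ is empty (so $S_3 = 001001$). The map $\phi$ sends the bit $0$ to $\sigma_n$ and the bit $1$ to $\sigma_{n-1}$.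 -}

module Defs where

open import Data.Nat using (ℕ; zero; suc; _+_; _∸_)
open import Data.Bool using (Bool; true; false; not)
open import Data.List using (List; []; _∷_; _++_; take; drop; reverse; map; concatMap; replicate)

-- Permutations of {1..n} in one-line notation are lists x₁ x₂ ⋯ xₙ.

rotate : {A : Set} → List A → List A
rotate []       = []
rotate (x ∷ xs) = xs ++ (x ∷ [])

σ : ℕ → List ℕ → List ℕ
σ k xs = rotate (take k xs) ++ drop k xs

-- Binary strings S_n (bit 0 = false, bit 1 = true), indexed so that S (m+2) = S_{m+2}.
S : ℕ → List Bool
S zero          = false ∷ false ∷ []
S (suc zero)    = false ∷ false ∷ []
S (suc (suc zero)) = false ∷ false ∷ []
S (suc (suc (suc k))) = concatMap (λ x → false ∷ false ∷ replicate k true ++ (not x ∷ [])) (S (suc (suc k)))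
-- S n for n ≥ 2 is the paper's S_n; S 0, S 1 are junk values never used.
-- Check: S 3 = 0 0 1^0 (not 0) 0 0 1^0 (not 0) = 001001.

φ : ℕ → Bool → List ℕ → List ℕ
φ n false = σ n
φ n true  = σ (n ∸ 1)

walk : ℕ → List Bool → List ℕ → List (List ℕ)
walk n []       g = g ∷ []
walk n (b ∷ bs) g = g ∷ walk n bs (φ n b g)

final : ℕ → List Bool → List ℕ → List ℕ
final n []       g = g
final n (b ∷ bs) g = final n bs (φ n b g)

oneTo : ℕ → List ℕ
oneTo zero    = []
oneTo (suc n) = oneTo n ++ (suc n ∷ [])

start : ℕ → List ℕ
start n = reverse (oneTo n)

module Submission where

-- The bits of S_{n+1} fall into blocks 0 0 1^{n-2} x̄, one for each bit x of S_n.  Started at M ∷ h, where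
-- M = n + 1 and h is a permutation of 1..n, the block for x visits the n + 1 words L ++ M ∷ R obtained by
-- inserting M into h or into a rotation of h, and stops at M ∷ φ_n(x) h.  Since start (n + 1) = M ∷ start n,
-- the walk for n + 1 shadows the walk for n with M in front, so it closes up because the walk for n does.
-- Conversely h can be read off from the split (L , R): it is R when L is empty, and otherwise R with its last
-- letter moved to the front, followed by L.  So the blocks of distinct h are disjoint and cover every
-- permutation of 1..n+1; if the walk for n lists each permutation of 1..n once, the walk for n + 1 lists each
-- permutation of 1..n+1 once.

open import Defs
open import Data.Bool using (Bool; true; false; not)
open import Data.Empty using (⊥-elim)
open import Data.List using (List; []; _∷_; _++_; [_]; _∷ʳ_; length; take; drop; reverse; map; concatMap; replicate; initLast; _∷ʳ′_)
open import Data.List.Properties using (length-++; length-++-comm; length-replicate; ++-assoc; ++-identityʳ; ++-conicalʳ; ∷ʳ-++; ∷-injective; map-++; take++drop≡id; take-all; drop-all; reverse-++; reverse-involutive)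
open import Data.List.Membership.Propositional using (_∈_; _∉_; find; lose)
open import Data.List.Membership.Propositional.Properties using (∈-++⁺ˡ; ∈-++⁺ʳ; ∈-++⁻; ∈-∃++; ∈-map⁺; ∈-concatMap⁺; ∈-concatMap⁻)
open import Data.List.Relation.Binary.Disjoint.Propositional using (Disjoint)
open import Data.List.Relation.Binary.Permutation.Propositional using (_↭_; ↭-refl; ↭-sym; ↭-trans; ↭-prep; ↭-reflexive)
open import Data.List.Relation.Binary.Permutation.Propositional.Properties using (shift; drop-mid; ++⁺ʳ; ++-comm; ∈-resp-↭; ↭-empty-inv; ↭-singleton-inv; ∷↭∷ʳ)
open import Data.List.Relation.Unary.All using (All; []; _∷_)
import Data.List.Relation.Unary.All as All
import Data.List.Relation.Unary.All.Properties as All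
open import Data.List.Relation.Unary.AllPairs using ([]; _∷_)
import Data.List.Relation.Unary.AllPairs as AllPairs
import Data.List.Relation.Unary.AllPairs.Properties as AllPairs
open import Data.List.Relation.Unary.Any using (here; there)
open import Data.List.Relation.Unary.Unique.Propositional using (Unique)
import Data.List.Relation.Unary.Unique.Propositional.Properties as Unique
open import Data.Nat using (ℕ; zero; suc; _+_; _*_; _∸_; _≤_; _<_; z≤n; s≤s; _!)
open import Data.Nat.Properties using (≤-refl; ≤-reflexive; ≤-trans; <-irrefl; n≤1+n; m≤n⇒m≤1+n; suc-injective; *-comm)
open import Data.Product using (_×_; _,_; proj₁; proj₂; ∃-syntax)
open import Data.Sum using (inj₁; inj₂)
open import Function using (_∘_)
open import Relation.Binary.PropositionalEquality using (_≡_; refl; sym; trans; cong; cong₂; subst; module ≡-Reasoning)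
open import Relation.Nullary using (¬_)

unique-map⁺ : {A B : Set} {P : A → Set} {f : A → B} {xs : List A} →
              (∀ {x y} → P x → P y → f x ≡ f y → x ≡ y) →
              All P xs → Unique xs → Unique (map f xs)
unique-map⁺ inj []         []          = []
unique-map⁺ inj (px ∷ pxs) (x∉ ∷ uniq) =
  All.map⁺ (All.zipWith (λ (py , x≢y) fx≡fy → x≢y (inj px py fx≡fy)) (pxs , x∉))
  ∷ unique-map⁺ inj pxs uniq

module _ {A : Set} where

  length-∷ʳ : (xs : List A) (x : A) → length (xs ∷ʳ x) ≡ suc (length xs)
  length-∷ʳ xs x = length-++-comm xs [ x ]

  take-length-++ : (xs ys : List A) → take (length xs) (xs ++ ys) ≡ xs
  take-length-++ []       ys = refl
  take-length-++ (x ∷ xs) ys = cong (x ∷_) (take-length-++ xs ys)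

  drop-length-++ : (xs ys : List A) → drop (length xs) (xs ++ ys) ≡ ys
  drop-length-++ []       ys = refl
  drop-length-++ (x ∷ xs) ys = drop-length-++ xs ys

  length-rotate : (xs : List A) → length (rotate xs) ≡ length xs
  length-rotate []       = refl
  length-rotate (x ∷ xs) = length-∷ʳ xs x

  unsnoc-length : ∀ {k} (h : List A) → length h ≡ suc (suc k) →
                  ∃[ a ] ∃[ P ] ∃[ z ] h ≡ a ∷ P ∷ʳ z × length P ≡ k
  unsnoc-length (a ∷ ys) eq with initLast ys
  ... | P ∷ʳ′ z = a , P , z , refl , suc-injective (trans (sym (length-∷ʳ P z)) (suc-injective eq))

  Split : Set
  Split = List A × List A

  plug : A → Split → List A
  plug M (L , R) = L ++ M ∷ R

  plug-injective : ∀ {M} L R L′ R′ → M ∉ L → M ∉ L′ →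
                   plug M (L , R) ≡ plug M (L′ , R′) → (L , R) ≡ (L′ , R′)
  plug-injective []      R []       R′ _   _    eq = cong ([] ,_) (proj₂ (∷-injective eq))
  plug-injective []      R (l ∷ L′) R′ _   M∉L′ eq = ⊥-elim (M∉L′ (here (proj₁ (∷-injective eq))))
  plug-injective (l ∷ L) R []       R′ M∉L _    eq = ⊥-elim (M∉L (here (sym (proj₁ (∷-injective eq)))))
  plug-injective (l ∷ L) R (l′ ∷ L′) R′ M∉L M∉L′ eq with refl , eq′ ← ∷-injective eq
    with refl ← plug-injective L R L′ R′ (M∉L ∘ there) (M∉L′ ∘ there) eq′ = refl

  unrotate : List A → List A
  unrotate xs with reverse xs
  ... | []     = []
  ... | a ∷ ra = a ∷ reverse ra

  unrotate-∷ʳ : (xs : List A) (a : A) → unrotate (xs ∷ʳ a) ≡ a ∷ xs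
  unrotate-∷ʳ xs a rewrite reverse-++ xs [ a ] | reverse-involutive xs = refl

  unrotate-↭ : (xs : List A) → unrotate xs ↭ xs
  unrotate-↭ xs with initLast xs
  ... | []       = ↭-refl
  ... | R ∷ʳ′ a = ↭-trans (↭-reflexive (unrotate-∷ʳ R a)) (∷↭∷ʳ a R)

  rotationSplits : A → List A → List A → List (Split)
  rotationSplits a []      Q = []
  rotationSplits a (y ∷ L) Q = (y ∷ L , Q ∷ʳ a) ∷ rotationSplits a L (Q ∷ʳ y)

  -- The block of S_{n+1} started at M ∷ h visits the vertices plug M p, p ∈ blockSplits h, in this order.
  blockSplits : List A → List (Split)
  blockSplits []       = []
  blockSplits (a ∷ ys) = ([] , a ∷ ys) ∷ (a ∷ ys , []) ∷ rotationSplits a ys []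

  blockOf : Split → List A
  blockOf ([]    , R) = R
  blockOf (l ∷ L , R) = unrotate R ++ l ∷ L

  blockOf-↭ : (p : Split) → blockOf p ↭ proj₁ p ++ proj₂ p
  blockOf-↭ ([]    , R) = ↭-refl
  blockOf-↭ (l ∷ L , R) = ↭-trans (++⁺ʳ (l ∷ L) (unrotate-↭ R)) (++-comm R (l ∷ L))

  blockOf-rotationSplits : ∀ a ys Q {p} → p ∈ rotationSplits a ys Q → blockOf p ≡ a ∷ Q ++ ys
  blockOf-rotationSplits a (y ∷ L) Q (here refl) = cong (_++ y ∷ L) (unrotate-∷ʳ Q a)
  blockOf-rotationSplits a (y ∷ L) Q (there p∈)  =
    trans (blockOf-rotationSplits a L (Q ∷ʳ y) p∈) (cong (a ∷_) (∷ʳ-++ Q y L))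

  blockOf-blockSplits : ∀ h {p} → p ∈ blockSplits h → blockOf p ≡ h
  blockOf-blockSplits (a ∷ ys) (here refl)         = refl
  blockOf-blockSplits (a ∷ ys) (there (here refl)) = refl
  blockOf-blockSplits (a ∷ ys) (there (there p∈))  = blockOf-rotationSplits a ys [] p∈

  ∈-rotationSplits : ∀ a Q P l L → (l ∷ L , (Q ++ P) ∷ʳ a) ∈ rotationSplits a (P ++ l ∷ L) Q
  ∈-rotationSplits a Q []      l L = here (cong (λ t → l ∷ L , t ∷ʳ a) (++-identityʳ Q))
  ∈-rotationSplits a Q (p ∷ P) l L =
    there (subst (λ t → (l ∷ L , t ∷ʳ a) ∈ rotationSplits a (P ++ l ∷ L) (Q ∷ʳ p))
                 (∷ʳ-++ Q p P) (∈-rotationSplits a (Q ∷ʳ p) P l L))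

  ∈-blockSplits-blockOf : ∀ L R → ¬ (L ++ R ≡ []) → (L , R) ∈ blockSplits (blockOf (L , R))
  ∈-blockSplits-blockOf []      []      L++R≢[] = ⊥-elim (L++R≢[] refl)
  ∈-blockSplits-blockOf []      (r ∷ R) _       = here refl
  ∈-blockSplits-blockOf (l ∷ L) R       _       with initLast R
  ... | []        = there (here refl)
  ... | R₀ ∷ʳ′ a rewrite unrotate-∷ʳ R₀ a = there (there (∈-rotationSplits a [] R₀ l L))

  rotationSplits-lengths : ∀ a ys Q →
    All (λ p → 0 < length (proj₁ p) × length Q < length (proj₂ p)) (rotationSplits a ys Q)
  rotationSplits-lengths a []      Q = []
  rotationSplits-lengths a (y ∷ L) Q =
    (s≤s z≤n , ≤-reflexive (sym (length-∷ʳ Q a)))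
    ∷ All.map (λ (0<L , Q∷ʳy<R) → 0<L , ≤-trans (n≤1+n _) (subst (_< _) (length-∷ʳ Q y) Q∷ʳy<R))
              (rotationSplits-lengths a L (Q ∷ʳ y))

  rotationSplits-unique : ∀ a ys Q → Unique (rotationSplits a ys Q)
  rotationSplits-unique a []      Q = []
  rotationSplits-unique a (y ∷ L) Q =
    All.map (λ { (_ , lt) refl → <-irrefl (trans (length-∷ʳ Q y) (sym (length-∷ʳ Q a))) lt })
            (rotationSplits-lengths a L (Q ∷ʳ y))
    ∷ rotationSplits-unique a L (Q ∷ʳ y)

  blockSplits-unique : ∀ h → Unique (blockSplits h)
  blockSplits-unique []       = []
  blockSplits-unique (a ∷ ys) =
    ((λ ()) ∷ All.map (λ { (0<L , _) refl → <-irrefl refl 0<L }) lengths)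
    ∷ All.map (λ { (_ , 0<R) refl → <-irrefl refl 0<R }) lengths
    ∷ rotationSplits-unique a ys []
    where lengths = rotationSplits-lengths a ys []

  concatMap-blockSplits-unique : ∀ {ws} → Unique ws → Unique (concatMap blockSplits ws)
  concatMap-blockSplits-unique {ws} uniq =
    Unique.concat⁺ (All.map⁺ (All.universal blockSplits-unique ws))
                   (AllPairs.map⁺ (AllPairs.map disjoint uniq))
    where
    disjoint : ∀ {h h′} → ¬ h ≡ h′ → Disjoint (blockSplits h) (blockSplits h′)
    disjoint {h} {h′} h≢h′ (p∈h , p∈h′) =
      h≢h′ (trans (sym (blockOf-blockSplits h p∈h)) (blockOf-blockSplits h′ p∈h′))

  Enumerates : List A → List (List A) → Set
  Enumerates O ws = All (_↭ O) ws × Unique ws × (∀ g → g ↭ O → g ∈ ws)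

  Enumerates-[_] : ∀ x → Enumerates [ x ] [ [ x ] ]
  Enumerates-[ x ] = ↭-refl ∷ [] , [] ∷ [] , λ g ρ → here (↭-singleton-inv ρ)

  concatMap-blockSplits-↭ : ∀ {O ws p} → All (_↭ O) ws →
                            p ∈ concatMap blockSplits ws → proj₁ p ++ proj₂ p ↭ O
  concatMap-blockSplits-↭ {O} {ws} {p} ws↭O p∈
    with h , h∈ws , p∈h ← find (∈-concatMap⁻ blockSplits {xs = ws} p∈) =
    ↭-trans (↭-sym (blockOf-↭ p)) (subst (_↭ O) (sym (blockOf-blockSplits h p∈h)) (All.lookup ws↭O h∈ws))

  Enumerates-insert : ∀ {M O ws} → M ∉ O → ¬ O ≡ [] → Enumerates O ws →
                      Enumerates (O ∷ʳ M) (map (plug M) (concatMap blockSplits ws))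
  Enumerates-insert {M} {O} {ws} M∉O O≢[] (ws↭O , ws-unique , ws-complete) = perms , unique , complete
    where
    splits-↭ : ∀ {p} → p ∈ concatMap blockSplits ws → proj₁ p ++ proj₂ p ↭ O
    splits-↭ = concatMap-blockSplits-↭ ws↭O

    perms : All (_↭ O ∷ʳ M) (map (plug M) (concatMap blockSplits ws))
    perms = All.map⁺ (All.tabulate λ { {L , R} p∈ →
      ↭-trans (shift M L R) (↭-trans (↭-prep M (splits-↭ p∈)) (∷↭∷ʳ M O)) })

    unique : Unique (map (plug M) (concatMap blockSplits ws))
    unique = unique-map⁺ (λ { {L , R} {L′ , R′} → plug-injective L R L′ R′ })
      (All.tabulate λ p∈ M∈L → M∉O (∈-resp-↭ (splits-↭ p∈) (∈-++⁺ˡ M∈L)))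
      (concatMap-blockSplits-unique ws-unique)

    complete : ∀ g → g ↭ O ∷ʳ M → g ∈ map (plug M) (concatMap blockSplits ws)
    complete g ρ with L , R , refl ← ∈-∃++ (∈-resp-↭ (↭-sym ρ) (∈-++⁺ʳ O (here refl))) =
      ∈-map⁺ (plug M) (∈-concatMap⁺ blockSplits
        (lose (ws-complete _ blockOf↭O) (∈-blockSplits-blockOf L R L++R≢[])))
      where
      L++R↭O : L ++ R ↭ O
      L++R↭O = subst (L ++ R ↭_) (++-identityʳ O) (drop-mid L O ρ)
      L++R≢[] : ¬ L ++ R ≡ []
      L++R≢[] e = O≢[] (↭-empty-inv (↭-sym (subst (_↭ O) e L++R↭O)))
      blockOf↭O : blockOf (L , R) ↭ O
      blockOf↭O = ↭-trans (blockOf-↭ (L , R)) L++R↭O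

length-σ : ∀ k xs → length (σ k xs) ≡ length xs
length-σ k xs = begin
  length (rotate (take k xs) ++ drop k xs)          ≡⟨ length-++ (rotate (take k xs)) ⟩
  length (rotate (take k xs)) + length (drop k xs)  ≡⟨ cong (_+ length (drop k xs)) (length-rotate (take k xs)) ⟩
  length (take k xs) + length (drop k xs)           ≡⟨ length-++ (take k xs) ⟨
  length (take k xs ++ drop k xs)                   ≡⟨ cong length (take++drop≡id k xs) ⟩
  length xs                                         ∎
  where open ≡-Reasoning

length-φ : ∀ n b xs → length (φ n b xs) ≡ length xs
length-φ n false = length-σ n
length-φ n true  = length-σ (n ∸ 1)

σ-++ : ∀ {k} (u v : List ℕ) → length u ≡ k → σ k (u ++ v) ≡ rotate u ++ v
σ-++ u v refl = cong₂ (λ t d → rotate t ++ d) (take-length-++ u v) (drop-length-++ u v)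

σ-rotate : ∀ {k} (u : List ℕ) → length u ≡ k → σ k u ≡ rotate u
σ-rotate u refl =
  trans (cong₂ (λ t d → rotate t ++ d) (take-all _ u ≤-refl) (drop-all _ u ≤-refl)) (++-identityʳ (rotate u))

σ-head : ∀ {k} x (xs ys : List ℕ) → length (x ∷ xs) ≡ k → σ k (x ∷ xs ++ ys) ≡ xs ++ x ∷ ys
σ-head x xs ys eq = trans (σ-++ (x ∷ xs) ys eq) (∷ʳ-++ xs x ys)

trail : ℕ → List Bool → List ℕ → List (List ℕ)
trail n []       g = []
trail n (b ∷ bs) g = g ∷ trail n bs (φ n b g)

trail-++ : ∀ n bs cs g → trail n (bs ++ cs) g ≡ trail n bs g ++ trail n cs (final n bs g)
trail-++ n []       cs g = refl
trail-++ n (b ∷ bs) cs g = cong (g ∷_) (trail-++ n bs cs (φ n b g))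

final-++ : ∀ n bs cs g → final n (bs ++ cs) g ≡ final n cs (final n bs g)
final-++ n []       cs g = refl
final-++ n (b ∷ bs) cs g = final-++ n bs cs (φ n b g)

take-length-walk : ∀ n bs g → take (length bs) (walk n bs g) ≡ trail n bs g
take-length-walk n []       g = refl
take-length-walk n (b ∷ bs) g = cong (g ∷_) (take-length-walk n bs (φ n b g))

length-trail : ∀ n bs g → length (trail n bs g) ≡ length bs
length-trail n []       g = refl
length-trail n (b ∷ bs) g = cong suc (length-trail n bs (φ n b g))

blockBits : ℕ → Bool → List Bool
blockBits k x = false ∷ false ∷ replicate k true ∷ʳ not x

-- Run from M ∷ a ∷ P ∷ʳ z with k = length P, the two 0s of blockBits k x lead to P ++ z ∷ M ∷ [ a ],
-- each 1 (a σ_{k+2}) carries the head of P over M, and the last bit ends at M ∷ φ (k + 2) x (a ∷ P ∷ʳ z).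

σ-rotations-step : ∀ {m} (M a p : ℕ) P z R₀ → length (p ∷ P ++ z ∷ M ∷ R₀) ≡ m →
                   σ m (p ∷ P ++ z ∷ M ∷ R₀ ∷ʳ a) ≡ P ++ z ∷ M ∷ R₀ ∷ʳ p ∷ʳ a
σ-rotations-step {m} M a p P z R₀ eq = begin
  σ m (p ∷ P ++ z ∷ M ∷ R₀ ∷ʳ a)  ≡⟨ cong (λ t → σ m (p ∷ t)) (++-assoc P (z ∷ M ∷ R₀) [ a ]) ⟨
  σ m (p ∷ u ++ [ a ])            ≡⟨ σ-head p u [ a ] eq ⟩
  u ++ p ∷ [ a ]                  ≡⟨ ++-assoc P (z ∷ M ∷ R₀) (p ∷ [ a ]) ⟩
  P ++ z ∷ M ∷ R₀ ++ p ∷ [ a ]    ≡⟨ cong (λ t → P ++ z ∷ M ∷ t) (∷ʳ-++ R₀ p [ a ]) ⟨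
  P ++ z ∷ M ∷ R₀ ∷ʳ p ∷ʳ a       ∎
  where
  open ≡-Reasoning
  u = P ++ z ∷ M ∷ R₀

length-rotations-step : ∀ {m} (M p : ℕ) P z R₀ → length (p ∷ P ++ z ∷ M ∷ R₀) ≡ m →
                        length (P ++ z ∷ M ∷ R₀ ∷ʳ p) ≡ m
length-rotations-step {m} M p P z R₀ eq =
  trans (cong length (sym (++-assoc P (z ∷ M ∷ R₀) [ p ]))) (trans (length-∷ʳ (P ++ z ∷ M ∷ R₀) p) eq)

rotations-trail : ∀ {m} (M a : ℕ) b P z R₀ → length (P ++ z ∷ M ∷ R₀) ≡ m →
  trail (suc m) (replicate (length P) true ∷ʳ b) (P ++ z ∷ M ∷ R₀ ∷ʳ a)
  ≡ map (plug M) (rotationSplits a (P ∷ʳ z) R₀)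
rotations-trail     M a b []      z R₀ eq = refl
rotations-trail {m} M a b (p ∷ P) z R₀ eq =
  cong₂ _∷_ (cong (p ∷_) (sym (∷ʳ-++ P z (M ∷ R₀ ∷ʳ a))))
            (trans (cong (trail (suc m) (replicate (length P) true ∷ʳ b)) (σ-rotations-step M a p P z R₀ eq))
                   (rotations-trail M a b P z (R₀ ∷ʳ p) (length-rotations-step {m} M p P z R₀ eq)))

rotations-final : ∀ {m} (M a : ℕ) b P z R₀ → length (P ++ z ∷ M ∷ R₀) ≡ m →
  final (suc m) (replicate (length P) true ∷ʳ b) (P ++ z ∷ M ∷ R₀ ∷ʳ a)
  ≡ φ (suc m) b (z ∷ M ∷ (R₀ ++ P) ∷ʳ a)
rotations-final {m} M a b []      z R₀ eq =
  cong (λ t → φ (suc m) b (z ∷ M ∷ t ∷ʳ a)) (sym (++-identityʳ R₀))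
rotations-final {m} M a b (p ∷ P) z R₀ eq =
  trans (cong (final (suc m) (replicate (length P) true ∷ʳ b)) (σ-rotations-step M a p P z R₀ eq))
        (trans (rotations-final M a b P z (R₀ ∷ʳ p) (length-rotations-step {m} M p P z R₀ eq))
               (cong (λ t → φ (suc m) b (z ∷ M ∷ t ∷ʳ a)) (∷ʳ-++ R₀ p P)))

module Block (M a : ℕ) (P : List ℕ) (z : ℕ) where

  private
    length-a∷P∷ʳz : length (a ∷ P ∷ʳ z) ≡ suc (suc (length P))
    length-a∷P∷ʳz = cong suc (length-∷ʳ P z)

    σ-once : σ (3 + length P) (M ∷ a ∷ P ∷ʳ z) ≡ (a ∷ P ∷ʳ z) ∷ʳ M
    σ-once = σ-rotate (M ∷ a ∷ P ∷ʳ z) (cong suc length-a∷P∷ʳz)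

    σ-twice : σ (3 + length P) (σ (3 + length P) (M ∷ a ∷ P ∷ʳ z)) ≡ P ++ z ∷ M ∷ [ a ]
    σ-twice = begin
      σ (3 + length P) (σ (3 + length P) (M ∷ a ∷ P ∷ʳ z))
        ≡⟨ cong (σ (3 + length P)) σ-once ⟩
      σ (3 + length P) ((a ∷ P ∷ʳ z) ∷ʳ M)
        ≡⟨ σ-rotate ((a ∷ P ∷ʳ z) ∷ʳ M) (trans (length-∷ʳ (a ∷ P ∷ʳ z) M) (cong suc length-a∷P∷ʳz)) ⟩
      P ∷ʳ z ∷ʳ M ∷ʳ a
        ≡⟨ ∷ʳ-++ (P ∷ʳ z) M [ a ] ⟩
      P ∷ʳ z ++ M ∷ [ a ]
        ≡⟨ ∷ʳ-++ P z (M ∷ [ a ]) ⟩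
      P ++ z ∷ M ∷ [ a ]
        ∎
      where open ≡-Reasoning

    length-P-z-M : length (P ++ z ∷ M ∷ []) ≡ 2 + length P
    length-P-z-M = length-++-comm P (z ∷ M ∷ [])

  trail≡ : ∀ x → trail (3 + length P) (blockBits (length P) x) (M ∷ a ∷ P ∷ʳ z)
                 ≡ map (plug M) (blockSplits (a ∷ P ∷ʳ z))
  trail≡ x =
    cong₂ (λ g t → (M ∷ a ∷ P ∷ʳ z) ∷ g ∷ t) σ-once
          (trans (cong (trail (3 + length P) (replicate (length P) true ∷ʳ not x)) σ-twice)
                 (rotations-trail M a (not x) P z [] length-P-z-M))

  φ-last-bit : ∀ x → φ (3 + length P) (not x) (z ∷ M ∷ P ∷ʳ a)
                     ≡ M ∷ φ (2 + length P) x (a ∷ P ∷ʳ z)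
  φ-last-bit false = trans (σ-head z (M ∷ P) [ a ] refl)
    (cong (M ∷_) (sym (trans (σ-rotate (a ∷ P ∷ʳ z) length-a∷P∷ʳz) (∷ʳ-++ P z [ a ]))))
  φ-last-bit true  = trans (σ-rotate (z ∷ M ∷ P ∷ʳ a) (cong (suc ∘ suc) (length-∷ʳ P a)))
    (cong (M ∷_) (trans (∷ʳ-++ P a [ z ]) (sym (σ-head a P [ z ] refl))))

  final≡ : ∀ x → final (3 + length P) (blockBits (length P) x) (M ∷ a ∷ P ∷ʳ z)
                 ≡ M ∷ φ (2 + length P) x (a ∷ P ∷ʳ z)
  final≡ x =
    trans (cong (final (3 + length P) (replicate (length P) true ∷ʳ not x)) σ-twice)
          (trans (rotations-final M a (not x) P z [] length-P-z-M) (φ-last-bit x))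

block-trail : ∀ {k} M x h → length h ≡ 2 + k →
              trail (3 + k) (blockBits k x) (M ∷ h) ≡ map (plug M) (blockSplits h)
block-trail M x h eq with a , P , z , refl , refl ← unsnoc-length h eq = Block.trail≡ M a P z x

block-final : ∀ {k} M x h → length h ≡ 2 + k →
              final (3 + k) (blockBits k x) (M ∷ h) ≡ M ∷ φ (2 + k) x h
block-final M x h eq with a , P , z , refl , refl ← unsnoc-length h eq = Block.final≡ M a P z x

lift-trail : ∀ {k} M bs h → length h ≡ 2 + k →
  trail (3 + k) (concatMap (blockBits k) bs) (M ∷ h) ≡ map (plug M) (concatMap blockSplits (trail (2 + k) bs h))
lift-trail     M []       h eq = refl
lift-trail {k} M (b ∷ bs) h eq = begin
  trail (3 + k) (blockBits k b ++ blocks) (M ∷ h)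
    ≡⟨ trail-++ (3 + k) (blockBits k b) blocks (M ∷ h) ⟩
  trail (3 + k) (blockBits k b) (M ∷ h) ++ trail (3 + k) blocks (final (3 + k) (blockBits k b) (M ∷ h))
    ≡⟨ cong₂ _++_ (block-trail M b h eq) (cong (trail (3 + k) blocks) (block-final M b h eq)) ⟩
  map (plug M) (blockSplits h) ++ trail (3 + k) blocks (M ∷ φ (2 + k) b h)
    ≡⟨ cong (map (plug M) (blockSplits h) ++_) (lift-trail M bs (φ (2 + k) b h) (trans (length-φ (2 + k) b h) eq)) ⟩
  map (plug M) (blockSplits h) ++ map (plug M) (concatMap blockSplits (trail (2 + k) bs (φ (2 + k) b h)))
    ≡⟨ map-++ (plug M) (blockSplits h) _ ⟨
  map (plug M) (concatMap blockSplits (trail (2 + k) (b ∷ bs) h))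
    ∎
  where
  open ≡-Reasoning
  blocks = concatMap (blockBits k) bs

lift-final : ∀ {k} M bs h → length h ≡ 2 + k →
  final (3 + k) (concatMap (blockBits k) bs) (M ∷ h) ≡ M ∷ final (2 + k) bs h
lift-final     M []       h eq = refl
lift-final {k} M (b ∷ bs) h eq = begin
  final (3 + k) (blockBits k b ++ blocks) (M ∷ h)
    ≡⟨ final-++ (3 + k) (blockBits k b) blocks (M ∷ h) ⟩
  final (3 + k) blocks (final (3 + k) (blockBits k b) (M ∷ h))
    ≡⟨ cong (final (3 + k) blocks) (block-final M b h eq) ⟩
  final (3 + k) blocks (M ∷ φ (2 + k) b h)
    ≡⟨ lift-final M bs (φ (2 + k) b h) (trans (length-φ (2 + k) b h) eq) ⟩
  M ∷ final (2 + k) bs (φ (2 + k) b h)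
    ∎
  where
  open ≡-Reasoning
  blocks = concatMap (blockBits k) bs

length-concatMap-blockBits : ∀ k bs → length (concatMap (blockBits k) bs) ≡ length bs * (3 + k)
length-concatMap-blockBits k []       = refl
length-concatMap-blockBits k (b ∷ bs) =
  trans (length-++ (blockBits k b)) (cong₂ _+_ length-blockBits (length-concatMap-blockBits k bs))
  where
  length-blockBits : length (blockBits k b) ≡ 3 + k
  length-blockBits =
    cong (suc ∘ suc) (trans (length-∷ʳ (replicate k true) (not b)) (cong suc (length-replicate k)))

length-S : ∀ k → length (S (2 + k)) ≡ (2 + k) !
length-S zero    = refl
length-S (suc k) = begin
  length (S (3 + k))           ≡⟨ length-concatMap-blockBits k (S (2 + k)) ⟩
  length (S (2 + k)) * (3 + k) ≡⟨ cong (_* (3 + k)) (length-S k) ⟩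
  (2 + k) ! * (3 + k)          ≡⟨ *-comm ((2 + k) !) (3 + k) ⟩
  (3 + k) !                    ∎
  where open ≡-Reasoning

oneTo-≤ : ∀ n {x} → x ∈ oneTo n → x ≤ n
oneTo-≤ (suc n) x∈ with ∈-++⁻ (oneTo n) x∈
... | inj₁ x∈oneTo-n = m≤n⇒m≤1+n (oneTo-≤ n x∈oneTo-n)
... | inj₂ (here refl) = ≤-refl

suc∉oneTo : ∀ n → suc n ∉ oneTo n
suc∉oneTo n = <-irrefl refl ∘ oneTo-≤ n

oneTo-suc≢[] : ∀ n → ¬ oneTo (suc n) ≡ []
oneTo-suc≢[] n eq with () ← ++-conicalʳ (oneTo n) [ suc n ] eq

start-suc : ∀ n → start (suc n) ≡ suc n ∷ start n
start-suc n = reverse-++ (oneTo n) [ suc n ]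

length-start : ∀ n → length (start n) ≡ n
length-start zero    = refl
length-start (suc n) = trans (cong length (start-suc n)) (cong suc (length-start n))

tour : ℕ → List (List ℕ)
tour n = trail n (S n) (start n)

tour-suc : ∀ k → tour (3 + k) ≡ map (plug (3 + k)) (concatMap blockSplits (tour (2 + k)))
tour-suc k = trans (cong (trail (3 + k) (S (3 + k))) (start-suc (2 + k)))
                   (lift-trail (3 + k) (S (2 + k)) (start (2 + k)) (length-start (2 + k)))

tour-enumerates : ∀ k → Enumerates (oneTo (2 + k)) (tour (2 + k))
tour-enumerates zero    = Enumerates-insert (suc∉oneTo 1) (oneTo-suc≢[] 0) Enumerates-[ 1 ]
tour-enumerates (suc k) rewrite tour-suc k =
  Enumerates-insert (suc∉oneTo (2 + k)) (oneTo-suc≢[] (suc k)) (tour-enumerates k)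

final-S-start : ∀ k → final (2 + k) (S (2 + k)) (start (2 + k)) ≡ start (2 + k)
final-S-start zero    = refl
final-S-start (suc k) = begin
  final (3 + k) (S (3 + k)) (start (3 + k))
    ≡⟨ cong (final (3 + k) (S (3 + k))) (start-suc (2 + k)) ⟩
  final (3 + k) (S (3 + k)) ((3 + k) ∷ start (2 + k))
    ≡⟨ lift-final (3 + k) (S (2 + k)) (start (2 + k)) (length-start (2 + k)) ⟩
  (3 + k) ∷ final (2 + k) (S (2 + k)) (start (2 + k))
    ≡⟨ cong ((3 + k) ∷_) (final-S-start k) ⟩
  (3 + k) ∷ start (2 + k)
    ≡⟨ start-suc (2 + k) ⟨
  start (3 + k)
    ∎
  where open ≡-Reasoning

take-walk≡tour : ∀ k → take ((2 + k) !) (walk (2 + k) (S (2 + k)) (start (2 + k))) ≡ tour (2 + k)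
take-walk≡tour k =
  trans (cong (λ m → take m (walk (2 + k) (S (2 + k)) (start (2 + k)))) (sym (length-S k)))
        (take-length-walk (2 + k) (S (2 + k)) (start (2 + k)))

theorem1 : (n : ℕ) → 2 ≤ n →
    length (S n) ≡ n ! ×
    length (take (n !) (walk n (S n) (start n))) ≡ n ! ×
    All (λ g → g ↭ oneTo n) (take (n !) (walk n (S n) (start n))) ×
    Unique (take (n !) (walk n (S n) (start n))) ×
    ((g : List ℕ) → g ↭ oneTo n → g ∈ take (n !) (walk n (S n) (start n))) ×
    final n (S n) (start n) ≡ start n
theorem1 (suc zero)    (s≤s ())
theorem1 (suc (suc k)) _ rewrite take-walk≡tour k =
  let perms , unique , complete = tour-enumerates k in
  length-S k , trans (length-trail (2 + k) (S (2 + k)) (start (2 + k))) (length-S k) ,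
  perms , unique , complete , final-S-start k
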